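{- Let $G=\{g_0,g_1,\dots,g_{N-1}\}$ be a finite Abelian group with $g_0=0$, and let $S=\{g_0,g_1,\dots,g_{n-1}\}\subseteq G$. Then $\operatorname{Aut}(G,S)^*$ is isomorphic to a subgroup of $\operatorname{Aut}(L_G(S))\cap S_{n-1}$. If moreover $S$ generates $G$, then $$\operatorname{Aut}(G,S)^*\cong\operatorname{Aut}(L_G(S))\cap S_{n-1}.$$
   Context: $G$ is written additively and its elements $g_0=0,g_1,\dots,g_{N-1}$ are distinct. The lattice is $$L_G(S)=\Big\{\big(x_1,\dots,x_{n-1},-\textstyle\sum_{i=1}^{n-1}x_i\big):x_i\in\mathbb{Z},\ \sum_{i=1}^{n-1}x_ig_i=0\Big\}\subseteq A_{n-1}=\{y\in\mathbb{Z}^n:\textstyle\sum y_i=0\}.$$ $\operatorname{Aut}(L_G(S))$ is the group of bijections of $L_G(S)$ onto itself that extend to linear isometries of $\operatorname{span}_\mathbb{R}A_{n-1}$. Each such map has the form $(x,-\sum x_i)\mapsto(Ux,-\sum(Ux)_i)$ with $U\in\mathrm{GL}_{n-1}(\mathbb{Z})$, and is identified with $U$. $S_{n-1}$ is identified with the group of $(n-1)\times(n-1)$ permutation matrices. Thus $\operatorname{Aut}(L_G(S))\cap S_{n-1}$ is the group of those automorphisms whose matrix $U$ is a permutation matrix. $\operatorname{Aut}(G,S)=\{\sigma\in\operatorname{Aut}(G):\sigma(g)\in S\text{ for all }g\in S\}$. $\operatorname{Aut}(G,S)^*$ is the group of permutations of $S$ that are restrictions of elements of $\operatorname{Aut}(G,S)$.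 -}

module Defs where

open import Data.Nat using (ℕ; zero; suc; _≤_; _<_)
open import Data.Fin using (Fin; zero; suc; toℕ; inject≤; _≟_)
open import Data.Fin.Permutation using (Permutation′; _⟨$⟩ʳ_)
open import Data.Integer as ℤ using (ℤ; +_; -[1+_])
open import Data.Product using (Σ; _×_; _,_; proj₁)
open import Function.Bundles using (_↔_; Inverse)
open import Relation.Nullary using (yes; no)
open import Relation.Binary.PropositionalEquality using (_≡_)
open import Algebra.Structures using (IsAbelianGroup)

-- A finite Abelian group G = {g_0, …, g_{N-1}}, presented with its
-- elements labelled by Fin N (element i is g_i); equality is ≡, so the
-- g_i are distinct.  The hypothesis g_0 = 0 is imposed in the theorem.

record FinAbGroup (N : ℕ) : Set where
  infixl 6 _⊕_
  field
    _⊕_ : Fin N → Fin N → Fin N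
    𝟘   : Fin N
    ⊖_  : Fin N → Fin N
    isAbelianGroup : IsAbelianGroup _≡_ _⊕_ 𝟘 ⊖_

sumℤ : ∀ {k} → (Fin k → ℤ) → ℤ
sumℤ {zero}  f = + 0
sumℤ {suc k} f = f zero ℤ.+ sumℤ (λ i → f (suc i))

Mat : ℕ → Set
Mat k = Fin k → Fin k → ℤ

_·ᵥ_ : ∀ {k} → Mat k → (Fin k → ℤ) → (Fin k → ℤ)
(U ·ᵥ x) i = sumℤ (λ j → U i j ℤ.* x j)

_·ₘ_ : ∀ {k} → Mat k → Mat k → Mat k
(U ·ₘ V) i j = sumℤ (λ l → U i l ℤ.* V l j)

permMat : ∀ {k} → Permutation′ k → Mat k
permMat π i j with i ≟ (π ⟨$⟩ʳ j)
... | yes _ = + 1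
... | no  _ = + 0

-- standard inner product in ℤ^n of the embedded vectors
-- (x_1,…,x_{n-1}, -Σ x_i) and (y_1,…,y_{n-1}, -Σ y_i)
embIP : ∀ {k} → (Fin k → ℤ) → (Fin k → ℤ) → ℤ
embIP x y = sumℤ (λ i → x i ℤ.* y i) ℤ.+ (ℤ.- sumℤ x) ℤ.* (ℤ.- sumℤ y)

module Setup {N k : ℕ} (G : FinAbGroup N) (h : suc k ≤ N) where
  open FinAbGroup G

  n : ℕ
  n = suc k

  InS : Fin N → Set
  InS a = toℕ a < n

  SElt : Set
  SElt = Σ (Fin N) InS

  -- g_{i+1} for i : Fin k  (i.e. g_1, …, g_{n-1})
  gS : Fin k → Fin N
  gS i = inject≤ (suc i) h

  natMul : ℕ → Fin N → Fin N
  natMul zero    a = 𝟘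
  natMul (suc m) a = a ⊕ natMul m a

  zMul : ℤ → Fin N → Fin N
  zMul (+ m)    a = natMul m a
  zMul -[1+ m ] a = ⊖ natMul (suc m) a

  sumG : ∀ {m} → (Fin m → Fin N) → Fin N
  sumG {zero}  f = 𝟘
  sumG {suc m} f = f zero ⊕ sumG (λ i → f (suc i))

  -- membership in L_G(S), via the coordinates x_1 … x_{n-1}
  InL : (Fin k → ℤ) → Set
  InL x = sumG (λ i → zMul (x i) (gS i)) ≡ 𝟘

  data InSpan : Fin N → Set where
    span-gen : ∀ {a} → InS a → InSpan a
    span-0   : InSpan 𝟘
    span-+   : ∀ {a b} → InSpan a → InSpan b → InSpan (a ⊕ b)
    span-neg : ∀ {a} → InSpan a → InSpan (⊖ a)

  Generates : Set
  Generates = ∀ a → InSpan a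

  record AutGS : Set where
    field
      σ      : Fin N ↔ Fin N
      hom    : ∀ a b → Inverse.to σ (a ⊕ b) ≡ Inverse.to σ a ⊕ Inverse.to σ b
      pres-S : ∀ a → InS a → InS (Inverse.to σ a)

  record AutGS* : Set where
    field
      τ          : SElt ↔ SElt
      restricted : Σ AutGS λ s →
                     ∀ x → proj₁ (Inverse.to τ x) ≡ Inverse.to (AutGS.σ s) (proj₁ x)

  _≈*_ : AutGS* → AutGS* → Set
  t ≈* t' = ∀ x → proj₁ (Inverse.to (AutGS*.τ t) x) ≡ proj₁ (Inverse.to (AutGS*.τ t') x)

  IsComp* : AutGS* → AutGS* → AutGS* → Set
  IsComp* t'' t t' = ∀ x → proj₁ (Inverse.to (AutGS*.τ t'') x)
                         ≡ proj₁ (Inverse.to (AutGS*.τ t) (Inverse.to (AutGS*.τ t') x))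

  -- Aut(L_G(S)) : the map induced by an integer matrix U is a bijection of
  -- L_G(S) onto itself that extends to a linear isometry of span A_{n-1}
  record IsAutL (U : Mat k) : Set where
    field
      into     : ∀ x → InL x → InL (U ·ᵥ x)
      inj      : ∀ x x' → InL x → InL x' → (∀ i → (U ·ᵥ x) i ≡ (U ·ᵥ x') i) → ∀ i → x i ≡ x' i
      onto     : ∀ y → InL y → Σ (Fin k → ℤ) λ x → InL x × (∀ i → (U ·ᵥ x) i ≡ y i)
      isometry : ∀ x y → InL x → InL y → embIP (U ·ᵥ x) (U ·ᵥ y) ≡ embIP x y

  record AutLPerm : Set where
    field
      π     : Permutation′ k
      isAut : IsAutL (permMat π)

  _≈L_ : AutLPerm → AutLPerm → Set
  u ≈L u' = ∀ i j → permMat (AutLPerm.π u) i j ≡ permMat (AutLPerm.π u') i j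

  IsCompL : AutLPerm → AutLPerm → AutLPerm → Set
  IsCompL u'' u u' = ∀ i j → permMat (AutLPerm.π u'') i j
                           ≡ (permMat (AutLPerm.π u) ·ₘ permMat (AutLPerm.π u')) i j

  record IsHom (f : AutGS* → AutLPerm) : Set where
    field
      cong : ∀ t t' → t ≈* t' → f t ≈L f t'
      comp : ∀ t'' t t' → IsComp* t'' t t' → IsCompL (f t'') (f t) (f t')

  record IsMono (f : AutGS* → AutLPerm) : Set where
    field
      hom       : IsHom f
      injective : ∀ t t' → f t ≈L f t' → t ≈* t'

  record IsIso (f : AutGS* → AutLPerm) : Set where
    field
      mono       : IsMono f
      surjective : ∀ u → Σ AutGS* λ t → f t ≈L u

{-# OPTIONS --safe #-}
module Submission where

-- An automorphism σ of G that preserves S fixes g₀ = 0, so it permutes g₁, …, g_{n-1}: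
-- σ g_i = g_{π i}.  Since Σ x_i g_{π i} = σ (Σ x_i g_i), the permutation matrix of π maps
-- L_G(S) into itself, and the same argument for σ⁻¹ and π⁻¹ makes it onto; permutation
-- matrices are isometries of A_{n-1}, and π determines σ on S, so σ ↦ π is an injective
-- homomorphism.  Conversely, if the permutation matrix of π is an automorphism of L_G(S),
-- then π and π⁻¹ both preserve every relation Σ x_i g_i = 0, so when S generates G the
-- assignment g_i ↦ g_{π i} extends to a well-defined endomorphism of G, inverted by the
-- one built from π⁻¹.

open import Defs
open import Data.Nat using (ℕ; suc; _≤_)
open import Data.Fin using (toℕ)
open import Data.Product using (Σ; _×_)
open import Data.Product using (_,_; proj₁; proj₂)
open import Relation.Binary.PropositionalEquality using (_≡_)

open import Algebra.Bundles using (CommutativeMonoid; Group; AbelianGroup)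
open import Algebra.Structures using (IsAbelianGroup)
import Algebra.Properties.Group as GroupProperties
import Algebra.Properties.Loop as LoopProperties
import Algebra.Properties.AbelianGroup as AbelianGroupProperties
import Algebra.Properties.CommutativeMonoid.Sum as CommutativeMonoidSum
open import Data.Nat using (zero; z≤n)
import Data.Nat as ℕ
import Data.Nat.Properties as ℕ
open import Data.Fin using (Fin; fromℕ<) renaming (zero to fzero; suc to fsuc)
open import Data.Fin.Properties using (suc-injective; _≟_; toℕ-injective; toℕ-inject≤; toℕ<n; toℕ-fromℕ<)
open import Data.Fin.Permutation using (Permutation′; permutation; _⟨$⟩ʳ_; _⟨$⟩ˡ_; inverseˡ; inverseʳ; flip)
open import Data.Integer using (ℤ; +_; -[1+_]; _+_; _*_; -_)
import Data.Integer as ℤ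
import Data.Integer.Properties as ℤ
open import Data.Empty using (⊥-elim)
open import Data.Sum using (_⊎_; inj₁; inj₂)
open import Function using (_∘_; id; _↔_; Inverse; Injection; mk↔ₛ′)
open import Function.Properties.Inverse using (↔⇒↣)
open import Relation.Nullary using (yes; no)
open import Relation.Binary.PropositionalEquality using (_≢_; _≗_; refl; sym; trans; cong; cong₂; subst; module ≡-Reasoning)

module FinSum {c ℓ} (M : CommutativeMonoid c ℓ) where
  open CommutativeMonoid M
    using (Carrier; _≈_; ε; ∙-cong; ∙-congˡ; ∙-congʳ; identityˡ; identityʳ)
    renaming (refl to ≈-refl; trans to ≈-trans)
  open CommutativeMonoidSum M public

  sum-zero : ∀ {m} (f : Fin m → Carrier) → (∀ i → f i ≈ ε) → sum f ≈ ε
  sum-zero {zero}  f f≈ε = ≈-refl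
  sum-zero {suc m} f f≈ε = ≈-trans (∙-cong (f≈ε fzero) (sum-zero (f ∘ fsuc) (f≈ε ∘ fsuc))) (identityˡ ε)

  sum-delta : ∀ {m} (f : Fin m → Carrier) j → (∀ i → i ≢ j → f i ≈ ε) → sum f ≈ f j
  sum-delta {suc m} f fzero     f≈ε = ≈-trans (∙-congˡ (sum-zero (f ∘ fsuc) (λ i → f≈ε (fsuc i) (λ ())))) (identityʳ _)
  sum-delta {suc m} f (fsuc j) f≈ε =
    ≈-trans (∙-congʳ (f≈ε fzero (λ ())))
      (≈-trans (identityˡ _) (sum-delta (f ∘ fsuc) j (λ i i≢j → f≈ε (fsuc i) (i≢j ∘ suc-injective))))

module ℤΣ = FinSum ℤ.+-0-commutativeMonoid

sumℤ≡sum : ∀ {m} (f : Fin m → ℤ) → sumℤ f ≡ ℤΣ.sum f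
sumℤ≡sum {zero}  f = refl
sumℤ≡sum {suc m} f = cong (λ s → f fzero + s) (sumℤ≡sum (f ∘ fsuc))

sumℤ-cong : ∀ {m} {f g : Fin m → ℤ} → f ≗ g → sumℤ f ≡ sumℤ g
sumℤ-cong {zero}  f≗g = refl
sumℤ-cong {suc m} f≗g = cong₂ _+_ (f≗g fzero) (sumℤ-cong (f≗g ∘ fsuc))

sumℤ-permute : ∀ {m} (f : Fin m → ℤ) (π : Permutation′ m) → sumℤ (f ∘ (π ⟨$⟩ʳ_)) ≡ sumℤ f
sumℤ-permute f π = begin
  sumℤ (f ∘ (π ⟨$⟩ʳ_))    ≡⟨ sumℤ≡sum (f ∘ (π ⟨$⟩ʳ_)) ⟩
  ℤΣ.sum (f ∘ (π ⟨$⟩ʳ_))  ≡⟨ sym (ℤΣ.sum-permute f π) ⟩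
  ℤΣ.sum f               ≡⟨ sym (sumℤ≡sum f) ⟩
  sumℤ f                 ∎
  where open ≡-Reasoning

sumℤ-delta : ∀ {m} (f : Fin m → ℤ) j → (∀ i → i ≢ j → f i ≡ + 0) → sumℤ f ≡ f j
sumℤ-delta f j f≡0 = trans (sumℤ≡sum f) (ℤΣ.sum-delta f j f≡0)

module _ {k : ℕ} (π : Permutation′ k) where

  permMat-on : ∀ {i j} → i ≡ π ⟨$⟩ʳ j → permMat π i j ≡ + 1
  permMat-on {i} {j} i≡πj with i ≟ π ⟨$⟩ʳ j
  ... | yes _   = refl
  ... | no i≢πj = ⊥-elim (i≢πj i≡πj)

  permMat-off : ∀ {i j} → i ≢ π ⟨$⟩ʳ j → permMat π i j ≡ + 0
  permMat-off {i} {j} i≢πj with i ≟ π ⟨$⟩ʳ j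
  ... | yes i≡πj = ⊥-elim (i≢πj i≡πj)
  ... | no _     = refl

  permMat-·ᵥ : ∀ x i → (permMat π ·ᵥ x) i ≡ x (π ⟨$⟩ˡ i)
  permMat-·ᵥ x i = begin
    sumℤ (λ j → permMat π i j * x j)   ≡⟨ sumℤ-delta _ (π ⟨$⟩ˡ i) off-diagonal ⟩
    permMat π i (π ⟨$⟩ˡ i) * x (π ⟨$⟩ˡ i) ≡⟨ cong (_* x (π ⟨$⟩ˡ i)) (permMat-on {j = π ⟨$⟩ˡ i} (sym (inverseʳ π))) ⟩
    + 1 * x (π ⟨$⟩ˡ i)                  ≡⟨ ℤ.*-identityˡ _ ⟩
    x (π ⟨$⟩ˡ i)                        ∎
    where
    open ≡-Reasoning
    off-diagonal : ∀ j → j ≢ π ⟨$⟩ˡ i → permMat π i j * x j ≡ + 0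
    off-diagonal j j≢πˡi = cong (_* x j) (permMat-off (λ i≡πj → j≢πˡi (trans (sym (inverseˡ π)) (cong (π ⟨$⟩ˡ_) (sym i≡πj)))))

  permMat-·ᵥ-injective : ∀ {x y} → (∀ i → (permMat π ·ᵥ x) i ≡ (permMat π ·ᵥ y) i) → x ≗ y
  permMat-·ᵥ-injective {x} {y} Px≡Py i = begin
    x i                      ≡⟨ cong x (sym (inverseˡ π)) ⟩
    x (π ⟨$⟩ˡ (π ⟨$⟩ʳ i))     ≡⟨ sym (permMat-·ᵥ x _) ⟩
    (permMat π ·ᵥ x) (π ⟨$⟩ʳ i) ≡⟨ Px≡Py (π ⟨$⟩ʳ i) ⟩
    (permMat π ·ᵥ y) (π ⟨$⟩ʳ i) ≡⟨ permMat-·ᵥ y _ ⟩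
    y (π ⟨$⟩ˡ (π ⟨$⟩ʳ i))     ≡⟨ cong y (inverseˡ π) ⟩
    y i                      ∎
    where open ≡-Reasoning

  sumℤ-permMat-·ᵥ : ∀ x → sumℤ (permMat π ·ᵥ x) ≡ sumℤ x
  sumℤ-permMat-·ᵥ x = trans (sumℤ-cong (permMat-·ᵥ x)) (sumℤ-permute x (flip π))

  embIP-permMat : ∀ x y → embIP (permMat π ·ᵥ x) (permMat π ·ᵥ y) ≡ embIP x y
  embIP-permMat x y = cong₂ _+_
    (trans (sumℤ-cong (λ i → cong₂ _*_ (permMat-·ᵥ x i) (permMat-·ᵥ y i)))
           (sumℤ-permute (λ i → x i * y i) (flip π)))
    (cong₂ (λ a b → (- a) * (- b)) (sumℤ-permMat-·ᵥ x) (sumℤ-permMat-·ᵥ y))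

permMat-cong : ∀ {k} (π π′ : Permutation′ k) {i j j′} → π ⟨$⟩ʳ j ≡ π′ ⟨$⟩ʳ j′ → permMat π i j ≡ permMat π′ i j′
permMat-cong π π′ {i} {j} πj≡π′j′ with i ≟ π ⟨$⟩ʳ j
... | yes i≡πj = sym (permMat-on π′ (trans i≡πj πj≡π′j′))
... | no i≢πj  = sym (permMat-off π′ (λ i≡π′j′ → i≢πj (trans i≡π′j′ (sym πj≡π′j′))))

permMat-injective : ∀ {k} (π π′ : Permutation′ k) → (∀ i j → permMat π i j ≡ permMat π′ i j) →
                    ∀ j → π ⟨$⟩ʳ j ≡ π′ ⟨$⟩ʳ j
permMat-injective π π′ P≡P′ j with π ⟨$⟩ʳ j ≟ π′ ⟨$⟩ʳ j
... | yes πj≡π′j = πj≡π′j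
... | no πj≢π′j with trans (sym (permMat-on π refl)) (trans (P≡P′ _ j) (permMat-off π′ πj≢π′j))
... | ()

permMat-·ₘ : ∀ {k} (π π′ π″ : Permutation′ k) → (∀ j → π″ ⟨$⟩ʳ j ≡ π ⟨$⟩ʳ (π′ ⟨$⟩ʳ j)) →
             ∀ i j → permMat π″ i j ≡ (permMat π ·ₘ permMat π′) i j
permMat-·ₘ π π′ π″ π″≗ππ′ i j = sym (begin
  sumℤ (λ l → permMat π i l * permMat π′ l j)  ≡⟨ sumℤ-delta _ (π′ ⟨$⟩ʳ j) off-diagonal ⟩
  permMat π i (π′ ⟨$⟩ʳ j) * permMat π′ _ j      ≡⟨ cong (permMat π i (π′ ⟨$⟩ʳ j) *_) (permMat-on π′ refl) ⟩
  permMat π i (π′ ⟨$⟩ʳ j) * + 1                 ≡⟨ ℤ.*-identityʳ _ ⟩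
  permMat π i (π′ ⟨$⟩ʳ j)                       ≡⟨ permMat-cong π π″ (sym (π″≗ππ′ j)) ⟩
  permMat π″ i j                                ∎)
  where
  open ≡-Reasoning
  off-diagonal : ∀ l → l ≢ π′ ⟨$⟩ʳ j → permMat π i l * permMat π′ l j ≡ + 0
  off-diagonal l l≢π′j = trans (cong (permMat π i l *_) (permMat-off π′ l≢π′j)) (ℤ.*-zeroʳ (permMat π i l))

module _ {N k : ℕ} (G : FinAbGroup N) (h : suc k ≤ N) where
  open FinAbGroup G
  open Setup G h
  open IsAbelianGroup isAbelianGroup
    using (assoc; comm; identityˡ; identityʳ; isGroup; isCommutativeMonoid)
    renaming (inverseʳ to ⊖-inverseʳ)
  open ≡-Reasoning

  private
    group : Group _ _
    group = record { isGroup = isGroup }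

    commutativeMonoid : CommutativeMonoid _ _
    commutativeMonoid = record { isCommutativeMonoid = isCommutativeMonoid }

    abelianGroup : AbelianGroup _ _
    abelianGroup = record { isAbelianGroup = isAbelianGroup }

    module GΣ = FinSum commutativeMonoid

  open GroupProperties group using (ε⁻¹≈ε; ⁻¹-involutive; inverseʳ-unique; x∙y⁻¹≈ε⇒x≈y; x≈y⇒x∙y⁻¹≈ε)
  open LoopProperties (GroupProperties.loop group) using (identityʳ-unique)

  sumG≡sum : ∀ {m} (f : Fin m → Fin N) → sumG f ≡ GΣ.sum f
  sumG≡sum {zero}  f = refl
  sumG≡sum {suc m} f = cong (f fzero ⊕_) (sumG≡sum (f ∘ fsuc))

  sumG-cong : ∀ {m} {f g : Fin m → Fin N} → f ≗ g → sumG f ≡ sumG g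
  sumG-cong {zero}  f≗g = refl
  sumG-cong {suc m} f≗g = cong₂ _⊕_ (f≗g fzero) (sumG-cong (f≗g ∘ fsuc))

  sumG-zero : ∀ {m} (f : Fin m → Fin N) → (∀ i → f i ≡ 𝟘) → sumG f ≡ 𝟘
  sumG-zero f f≡𝟘 = trans (sumG≡sum f) (GΣ.sum-zero f f≡𝟘)

  sumG-delta : ∀ {m} (f : Fin m → Fin N) j → (∀ i → i ≢ j → f i ≡ 𝟘) → sumG f ≡ f j
  sumG-delta f j f≡𝟘 = trans (sumG≡sum f) (GΣ.sum-delta f j f≡𝟘)

  sumG-permute : ∀ {m} (f : Fin m → Fin N) (π : Permutation′ m) → sumG (f ∘ (π ⟨$⟩ʳ_)) ≡ sumG f
  sumG-permute f π = begin
    sumG (f ∘ (π ⟨$⟩ʳ_))    ≡⟨ sumG≡sum (f ∘ (π ⟨$⟩ʳ_)) ⟩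
    GΣ.sum (f ∘ (π ⟨$⟩ʳ_))  ≡⟨ sym (GΣ.sum-permute f π) ⟩
    GΣ.sum f               ≡⟨ sym (sumG≡sum f) ⟩
    sumG f                 ∎

  sumG-distrib : ∀ {m} (f g : Fin m → Fin N) → sumG (λ i → f i ⊕ g i) ≡ sumG f ⊕ sumG g
  sumG-distrib f g = begin
    sumG (λ i → f i ⊕ g i)    ≡⟨ sumG≡sum (λ i → f i ⊕ g i) ⟩
    GΣ.sum (λ i → f i ⊕ g i)  ≡⟨ GΣ.∑-distrib-+ f g ⟩
    GΣ.sum f ⊕ GΣ.sum g       ≡⟨ sym (cong₂ _⊕_ (sumG≡sum f) (sumG≡sum g)) ⟩
    sumG f ⊕ sumG g           ∎

  Additive : (Fin N → Fin N) → Set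
  Additive φ = ∀ a b → φ (a ⊕ b) ≡ φ a ⊕ φ b

  ⊖-additive : Additive ⊖_
  ⊖-additive a b = sym (AbelianGroupProperties.⁻¹-∙-comm abelianGroup a b)

  ∘-additive : ∀ {φ ψ} → Additive φ → Additive ψ → Additive (φ ∘ ψ)
  ∘-additive {φ} {ψ} φ-additive ψ-additive a b = trans (cong φ (ψ-additive a b)) (φ-additive (ψ a) (ψ b))

  from-additive : (σ : Fin N ↔ Fin N) → Additive (Inverse.to σ) → Additive (Inverse.from σ)
  from-additive σ σ-additive a b = begin
    from (a ⊕ b)                          ≡⟨ cong from (sym (cong₂ _⊕_ (Inverse.strictlyInverseˡ σ a) (Inverse.strictlyInverseˡ σ b))) ⟩
    from (to (from a) ⊕ to (from b))      ≡⟨ cong from (sym (σ-additive (from a) (from b))) ⟩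
    from (to (from a ⊕ from b))           ≡⟨ Inverse.strictlyInverseʳ σ _ ⟩
    from a ⊕ from b                       ∎
    where open Inverse σ using (to; from)

  natMul-+ : ∀ m m′ a → natMul (m ℕ.+ m′) a ≡ natMul m a ⊕ natMul m′ a
  natMul-+ zero    m′ a = sym (identityˡ _)
  natMul-+ (suc m) m′ a = trans (cong (a ⊕_) (natMul-+ m m′ a)) (sym (assoc _ _ _))

  zMul-⊖ : ∀ m m′ a → zMul (m ℤ.⊖ m′) a ≡ natMul m a ⊕ ⊖ natMul m′ a
  zMul-⊖ m zero a = begin
    zMul (m ℤ.⊖ 0) a      ≡⟨ cong (λ z → zMul z a) (ℤ.⊖-≥ {m} z≤n) ⟩
    natMul m a            ≡⟨ sym (identityʳ _) ⟩
    natMul m a ⊕ 𝟘        ≡⟨ cong (natMul m a ⊕_) (sym ε⁻¹≈ε) ⟩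
    natMul m a ⊕ ⊖ 𝟘      ∎
  zMul-⊖ zero    (suc m′) a = sym (identityˡ _)
  zMul-⊖ (suc m) (suc m′) a = begin
    zMul (suc m ℤ.⊖ suc m′) a                    ≡⟨ cong (λ z → zMul z a) (ℤ.[1+m]⊖[1+n]≡m⊖n m m′) ⟩
    zMul (m ℤ.⊖ m′) a                            ≡⟨ zMul-⊖ m m′ a ⟩
    natMul m a ⊕ ⊖ natMul m′ a                   ≡⟨ sym (cancel-common a (natMul m a) (natMul m′ a)) ⟩
    (a ⊕ natMul m a) ⊕ ⊖ (a ⊕ natMul m′ a)       ∎
    where
    cancel-common : ∀ c x y → (c ⊕ x) ⊕ ⊖ (c ⊕ y) ≡ x ⊕ ⊖ y
    cancel-common c x y = begin
      (c ⊕ x) ⊕ ⊖ (c ⊕ y)     ≡⟨ cong₂ _⊕_ (comm c x) (⊖-additive c y) ⟩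
      (x ⊕ c) ⊕ (⊖ c ⊕ ⊖ y)   ≡⟨ assoc _ _ _ ⟩
      x ⊕ (c ⊕ (⊖ c ⊕ ⊖ y))   ≡⟨ cong (x ⊕_) (sym (assoc _ _ _)) ⟩
      x ⊕ ((c ⊕ ⊖ c) ⊕ ⊖ y)   ≡⟨ cong (λ z → x ⊕ (z ⊕ ⊖ y)) (⊖-inverseʳ c) ⟩
      x ⊕ (𝟘 ⊕ ⊖ y)           ≡⟨ cong (x ⊕_) (identityˡ _) ⟩
      x ⊕ ⊖ y                 ∎

  zMul-+ : ∀ z z′ a → zMul (z ℤ.+ z′) a ≡ zMul z a ⊕ zMul z′ a
  zMul-+ (+ m)    (+ m′)    a = natMul-+ m m′ a
  zMul-+ (+ m)    -[1+ m′ ] a = zMul-⊖ m (suc m′) a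
  zMul-+ -[1+ m ] (+ m′)    a = trans (zMul-⊖ m′ (suc m) a) (comm _ _)
  zMul-+ -[1+ m ] -[1+ m′ ] a = begin
    ⊖ natMul (suc (suc (m ℕ.+ m′))) a           ≡⟨ cong (λ l → ⊖ natMul (suc l) a) (sym (ℕ.+-suc m m′)) ⟩
    ⊖ natMul (suc m ℕ.+ suc m′) a               ≡⟨ cong ⊖_ (natMul-+ (suc m) (suc m′) a) ⟩
    ⊖ (natMul (suc m) a ⊕ natMul (suc m′) a)    ≡⟨ ⊖-additive _ _ ⟩
    ⊖ natMul (suc m) a ⊕ ⊖ natMul (suc m′) a    ∎

  zMul-neg : ∀ z a → zMul (ℤ.- z) a ≡ ⊖ zMul z a
  zMul-neg (+ zero)  a = sym ε⁻¹≈ε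
  zMul-neg (+ suc m) a = refl
  zMul-neg -[1+ m ]  a = sym (⁻¹-involutive _)

  module _ {φ : Fin N → Fin N} (φ-additive : Additive φ) where

    additive-𝟘 : φ 𝟘 ≡ 𝟘
    additive-𝟘 = identityʳ-unique (φ 𝟘) (φ 𝟘) (trans (sym (φ-additive 𝟘 𝟘)) (cong φ (identityˡ 𝟘)))

    additive-⊖ : ∀ a → φ (⊖ a) ≡ ⊖ φ a
    additive-⊖ a = inverseʳ-unique (φ a) (φ (⊖ a)) (trans (sym (φ-additive a (⊖ a))) (trans (cong φ (⊖-inverseʳ a)) additive-𝟘))

    additive-natMul : ∀ m a → φ (natMul m a) ≡ natMul m (φ a)
    additive-natMul zero    a = additive-𝟘
    additive-natMul (suc m) a = trans (φ-additive _ _) (cong (φ a ⊕_) (additive-natMul m a))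

    additive-zMul : ∀ z a → φ (zMul z a) ≡ zMul z (φ a)
    additive-zMul (+ m)    a = additive-natMul m a
    additive-zMul -[1+ m ] a = trans (additive-⊖ _) (cong ⊖_ (additive-natMul (suc m) a))

    additive-sumG : ∀ {m} (f : Fin m → Fin N) → φ (sumG f) ≡ sumG (φ ∘ f)
    additive-sumG {zero}  f = additive-𝟘
    additive-sumG {suc m} f = trans (φ-additive _ _) (cong (φ (f fzero) ⊕_) (additive-sumG (f ∘ fsuc)))

  lincomb : ∀ {m} → (Fin m → Fin N) → (Fin m → ℤ) → Fin N
  lincomb v c = sumG (λ i → zMul (c i) (v i))

  lincomb-cong : ∀ {m} {v v′ : Fin m → Fin N} {c c′ : Fin m → ℤ} → v ≗ v′ → c ≗ c′ → lincomb v c ≡ lincomb v′ c′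
  lincomb-cong v≗v′ c≗c′ = sumG-cong (λ i → cong₂ zMul (c≗c′ i) (v≗v′ i))

  lincomb-+ : ∀ {m} (v : Fin m → Fin N) c c′ → lincomb v (λ i → c i ℤ.+ c′ i) ≡ lincomb v c ⊕ lincomb v c′
  lincomb-+ v c c′ = trans (sumG-cong (λ i → zMul-+ (c i) (c′ i) (v i)))
                           (sumG-distrib (λ i → zMul (c i) (v i)) (λ i → zMul (c′ i) (v i)))

  lincomb-neg : ∀ {m} (v : Fin m → Fin N) c → lincomb v (λ i → ℤ.- c i) ≡ ⊖ lincomb v c
  lincomb-neg v c = trans (sumG-cong (λ i → zMul-neg (c i) (v i))) (sym (additive-sumG ⊖-additive (λ i → zMul (c i) (v i))))

  lincomb-− : ∀ {m} (v : Fin m → Fin N) c c′ → lincomb v (λ i → c i ℤ.- c′ i) ≡ lincomb v c ⊕ ⊖ lincomb v c′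
  lincomb-− v c c′ = trans (lincomb-+ v c (λ i → ℤ.- c′ i)) (cong (lincomb v c ⊕_) (lincomb-neg v c′))

  lincomb-0 : ∀ {m} (v : Fin m → Fin N) → lincomb v (λ _ → + 0) ≡ 𝟘
  lincomb-0 v = sumG-zero (λ i → zMul (+ 0) (v i)) (λ _ → refl)

  unitVector : ∀ {m} → Fin m → Fin m → ℤ
  unitVector j i with i ≟ j
  ... | yes _ = + 1
  ... | no _  = + 0

  lincomb-unitVector : ∀ {m} (v : Fin m → Fin N) j → lincomb v (unitVector j) ≡ v j
  lincomb-unitVector v j = trans (sumG-delta _ j off-j) on-j
    where
    off-j : ∀ i → i ≢ j → zMul (unitVector j i) (v i) ≡ 𝟘
    off-j i i≢j with i ≟ j
    ... | yes i≡j = ⊥-elim (i≢j i≡j)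
    ... | no _    = refl
    on-j : zMul (unitVector j j) (v j) ≡ v j
    on-j with j ≟ j
    ... | yes _  = identityʳ _
    ... | no j≢j = ⊥-elim (j≢j refl)

  lincomb-permute : ∀ {m} (π : Permutation′ m) v c →
                    lincomb (v ∘ (π ⟨$⟩ʳ_)) (c ∘ (π ⟨$⟩ʳ_)) ≡ lincomb v c
  lincomb-permute π v c = sumG-permute (λ i → zMul (c i) (v i)) π

  lincomb-∘ʳ : ∀ {m} (π : Permutation′ m) v c → lincomb (v ∘ (π ⟨$⟩ʳ_)) c ≡ lincomb v (c ∘ (π ⟨$⟩ˡ_))
  lincomb-∘ʳ π v c = begin
    lincomb (v ∘ (π ⟨$⟩ʳ_)) c                            ≡⟨ lincomb-cong {v = v ∘ (π ⟨$⟩ʳ_)} (λ _ → refl) (λ i → cong c (sym (inverseˡ π))) ⟩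
    lincomb (v ∘ (π ⟨$⟩ʳ_)) (c ∘ (π ⟨$⟩ˡ_) ∘ (π ⟨$⟩ʳ_))  ≡⟨ lincomb-permute π v (c ∘ (π ⟨$⟩ˡ_)) ⟩
    lincomb v (c ∘ (π ⟨$⟩ˡ_))                            ∎

  lincomb-permMat : (π : Permutation′ k) (v : Fin k → Fin N) (x : Fin k → ℤ) →
                    lincomb v (permMat π ·ᵥ x) ≡ lincomb (v ∘ (π ⟨$⟩ʳ_)) x
  lincomb-permMat π v x = trans (lincomb-cong {v = v} (λ _ → refl) (permMat-·ᵥ π x)) (sym (lincomb-∘ʳ π v x))

  additive-lincomb : ∀ {φ} → Additive φ → ∀ {m} (v : Fin m → Fin N) c → φ (lincomb v c) ≡ lincomb (φ ∘ v) c
  additive-lincomb φ-additive v c =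
    trans (additive-sumG φ-additive (λ i → zMul (c i) (v i))) (sumG-cong (λ i → additive-zMul φ-additive (c i) (v i)))

  PreservesRelations : (Fin k → Fin k) → Set
  PreservesRelations ρ = ∀ x → InL x → lincomb (gS ∘ ρ) x ≡ 𝟘

  permMat-isAutL : (π : Permutation′ k) →
                   PreservesRelations (π ⟨$⟩ʳ_) → PreservesRelations (π ⟨$⟩ˡ_) → IsAutL (permMat π)
  permMat-isAutL π πʳ-preserves πˡ-preserves = record
    { into     = λ x x∈L → trans (lincomb-permMat π gS x) (πʳ-preserves x x∈L)
    ; inj      = λ _ _ _ _ → permMat-·ᵥ-injective π
    ; onto     = λ y y∈L → y ∘ (π ⟨$⟩ʳ_)
                         , trans (sym (lincomb-∘ʳ (flip π) gS y)) (πˡ-preserves y y∈L)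
                         , λ i → trans (permMat-·ᵥ π _ i) (cong y (inverseʳ π))
    ; isometry = λ x y _ _ → embIP-permMat π x y
    }

  isAutL-preservesRelations : (π : Permutation′ k) → IsAutL (permMat π) →
                              PreservesRelations (π ⟨$⟩ʳ_) × PreservesRelations (π ⟨$⟩ˡ_)
  isAutL-preservesRelations π isAut =
    (λ x x∈L → trans (sym (lincomb-permMat π gS x)) (IsAutL.into isAut x x∈L)) , πˡ-preserves
    where
    πˡ-preserves : PreservesRelations (π ⟨$⟩ˡ_)
    πˡ-preserves y y∈L with IsAutL.onto isAut y y∈L
    ... | x , x∈L , Px≡y = begin
      lincomb (gS ∘ (π ⟨$⟩ˡ_)) y                          ≡⟨ lincomb-cong {v = gS ∘ (π ⟨$⟩ˡ_)} (λ _ → refl) (λ i → trans (sym (Px≡y i)) (permMat-·ᵥ π x i)) ⟩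
      lincomb (gS ∘ (π ⟨$⟩ˡ_)) (x ∘ (π ⟨$⟩ˡ_))            ≡⟨ lincomb-permute (flip π) gS x ⟩
      lincomb gS x                                        ≡⟨ x∈L ⟩
      𝟘                                                  ∎

  additive-preservesRelations : ∀ {φ ρ} → Additive φ → (∀ i → φ (gS i) ≡ gS (ρ i)) → PreservesRelations ρ
  additive-preservesRelations {φ} {ρ} φ-additive φ∘gS≗gS∘ρ x x∈L = begin
    lincomb (gS ∘ ρ) x  ≡⟨ lincomb-cong {c = x} (sym ∘ φ∘gS≗gS∘ρ) (λ _ → refl) ⟩
    lincomb (φ ∘ gS) x  ≡⟨ sym (additive-lincomb φ-additive gS x) ⟩
    φ (lincomb gS x)    ≡⟨ cong φ x∈L ⟩
    φ 𝟘                 ≡⟨ additive-𝟘 φ-additive ⟩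
    𝟘                   ∎

  preservesRelations-lincomb : ∀ {ρ} → PreservesRelations ρ → ∀ {c c′} →
                               lincomb gS c ≡ lincomb gS c′ → lincomb (gS ∘ ρ) c ≡ lincomb (gS ∘ ρ) c′
  preservesRelations-lincomb {ρ} ρ-preserves {c} {c′} gc≡gc′ =
    x∙y⁻¹≈ε⇒x≈y _ _ (trans (sym (lincomb-− (gS ∘ ρ) c c′)) (ρ-preserves c-c′ c-c′∈L))
    where
    c-c′ : Fin k → ℤ
    c-c′ i = c i ℤ.- c′ i
    c-c′∈L : InL c-c′
    c-c′∈L = trans (lincomb-− gS c c′) (x≈y⇒x∙y⁻¹≈ε gc≡gc′)

  SElt-≡ : ∀ {x y : SElt} → proj₁ x ≡ proj₁ y → x ≡ y
  SElt-≡ {a , a∈S} {.a , a∈S′} refl = cong (a ,_) (ℕ.≤-irrelevant a∈S a∈S′)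

  restrictToS : (σ : Fin N ↔ Fin N) → Additive (Inverse.to σ) →
                (∀ a → InS a → InS (Inverse.to σ a)) → (∀ a → InS a → InS (Inverse.from σ a)) → AutGS*
  restrictToS σ σ-additive to-S from-S = record
    { τ          = mk↔ₛ′ (λ (a , a∈S) → to a , to-S a a∈S) (λ (a , a∈S) → from a , from-S a a∈S)
                         (λ _ → SElt-≡ (strictlyInverseˡ _)) (λ _ → SElt-≡ (strictlyInverseʳ _))
    ; restricted = record { σ = σ ; hom = σ-additive ; pres-S = to-S } , λ _ → refl
    }
    where open Inverse σ using (to; from; strictlyInverseˡ; strictlyInverseʳ)

  module _ (toℕ-𝟘 : toℕ 𝟘 ≡ 0) where

    toℕ-gS : ∀ i → toℕ (gS i) ≡ suc (toℕ i)
    toℕ-gS i = toℕ-inject≤ (fsuc i) h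

    gS-injective : ∀ {i j} → gS i ≡ gS j → i ≡ j
    gS-injective {i} {j} gi≡gj =
      toℕ-injective (ℕ.suc-injective (trans (sym (toℕ-gS i)) (trans (cong toℕ gi≡gj) (toℕ-gS j))))

    gS∈S : ∀ i → InS (gS i)
    gS∈S i = subst (ℕ._< n) (sym (toℕ-gS i)) (ℕ.s≤s (toℕ<n i))

    gS≢𝟘 : ∀ i → gS i ≢ 𝟘
    gS≢𝟘 i gi≡𝟘 = ℕ.0≢1+n (trans (sym toℕ-𝟘) (trans (cong toℕ (sym gi≡𝟘)) (toℕ-gS i)))

    𝟘∈S : InS 𝟘
    𝟘∈S = subst (ℕ._< n) (sym toℕ-𝟘) (ℕ.s≤s z≤n)

    S-index : ∀ a → InS a → a ≢ 𝟘 → Σ (Fin k) λ j → gS j ≡ a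
    S-index a a∈S a≢𝟘 with toℕ a in toℕa≡
    ... | zero  = ⊥-elim (a≢𝟘 (toℕ-injective (trans toℕa≡ (sym toℕ-𝟘))))
    ... | suc m = fromℕ< (ℕ.s<s⁻¹ a∈S)
                , toℕ-injective (trans (toℕ-gS _) (trans (cong suc (toℕ-fromℕ< _)) (sym toℕa≡)))

    S-cases : ∀ a → InS a → a ≡ 𝟘 ⊎ Σ (Fin k) λ j → gS j ≡ a
    S-cases a a∈S with a ≟ 𝟘
    ... | yes a≡𝟘 = inj₁ a≡𝟘
    ... | no a≢𝟘  = inj₂ (S-index a a∈S a≢𝟘)

    additive-agree-on-S : ∀ {φ ψ} → Additive φ → Additive ψ → (∀ j → φ (gS j) ≡ ψ (gS j)) →
                          ∀ a → InS a → φ a ≡ ψ a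
    additive-agree-on-S φ-additive ψ-additive agree a a∈S with S-cases a a∈S
    ... | inj₁ refl       = trans (additive-𝟘 φ-additive) (sym (additive-𝟘 ψ-additive))
    ... | inj₂ (j , refl) = agree j

    gSElt : Fin k → SElt
    gSElt j = gS j , gS∈S j

    Reflects𝟘 : (SElt → SElt) → Set
    Reflects𝟘 f = ∀ x → proj₁ (f x) ≡ 𝟘 → proj₁ x ≡ 𝟘

    module _ (f : SElt → SElt) (f-reflects𝟘 : Reflects𝟘 f) where

      private
        indexOf-f : ∀ i → Σ (Fin k) λ j → gS j ≡ proj₁ (f (gSElt i))
        indexOf-f i = S-index (proj₁ (f (gSElt i))) (proj₂ (f (gSElt i))) (gS≢𝟘 i ∘ f-reflects𝟘 (gSElt i))

      index : Fin k → Fin k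
      index i = proj₁ (indexOf-f i)

      gSElt-index : ∀ i → gSElt (index i) ≡ f (gSElt i)
      gSElt-index i = SElt-≡ (proj₂ (indexOf-f i))

    restrictPerm : (τ : SElt ↔ SElt) → Reflects𝟘 (Inverse.to τ) → Reflects𝟘 (Inverse.from τ) → Permutation′ k
    restrictPerm τ to-reflects𝟘 from-reflects𝟘 =
      permutation (index to to-reflects𝟘) (index from from-reflects𝟘)
                  (index-inverse {to} {from} to-reflects𝟘 from-reflects𝟘 strictlyInverseˡ)
                  (index-inverse {from} {to} from-reflects𝟘 to-reflects𝟘 strictlyInverseʳ)
      where
      open Inverse τ using (to; from; strictlyInverseˡ; strictlyInverseʳ)
      index-inverse : ∀ {f g} (f-r : Reflects𝟘 f) (g-r : Reflects𝟘 g) → (∀ x → f (g x) ≡ x) →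
                      ∀ j → index f f-r (index g g-r j) ≡ j
      index-inverse {f} {g} f-r g-r f∘g≗id j = gS-injective (cong proj₁ (begin
        gSElt (index f f-r (index g g-r j)) ≡⟨ gSElt-index f f-r _ ⟩
        f (gSElt (index g g-r j))           ≡⟨ cong f (gSElt-index g g-r j) ⟩
        f (g (gSElt j))                     ≡⟨ f∘g≗id _ ⟩
        gSElt j                             ∎))

    module Restriction (t : AutGS*) where
      open AutGS* t using (τ)
      open Inverse τ using (to; from; strictlyInverseˡ)
      open AutGS (proj₁ (AutGS*.restricted t)) public using (σ) renaming (hom to σ-additive)

      τ≡σ : ∀ x → proj₁ (to x) ≡ Inverse.to σ (proj₁ x)
      τ≡σ = proj₂ (AutGS*.restricted t)

      to-reflects𝟘 : Reflects𝟘 to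
      to-reflects𝟘 x τx≡𝟘 = Injection.injective (↔⇒↣ σ) (trans (sym (τ≡σ x)) (trans τx≡𝟘 (sym (additive-𝟘 σ-additive))))

      from-reflects𝟘 : Reflects𝟘 from
      from-reflects𝟘 x τ⁻¹x≡𝟘 = begin
        proj₁ x                     ≡⟨ cong proj₁ (sym (strictlyInverseˡ x)) ⟩
        proj₁ (to (from x))         ≡⟨ τ≡σ (from x) ⟩
        Inverse.to σ (proj₁ (from x)) ≡⟨ cong (Inverse.to σ) τ⁻¹x≡𝟘 ⟩
        Inverse.to σ 𝟘              ≡⟨ additive-𝟘 σ-additive ⟩
        𝟘                           ∎

      perm : Permutation′ k
      perm = restrictPerm τ to-reflects𝟘 from-reflects𝟘

      gS-perm : ∀ i → gS (perm ⟨$⟩ʳ i) ≡ proj₁ (to (gSElt i))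
      gS-perm i = cong proj₁ (gSElt-index to to-reflects𝟘 i)

      σ-gS : ∀ i → Inverse.to σ (gS i) ≡ gS (perm ⟨$⟩ʳ i)
      σ-gS i = sym (trans (gS-perm i) (τ≡σ (gSElt i)))

      σ⁻¹-gS : ∀ i → Inverse.from σ (gS i) ≡ gS (perm ⟨$⟩ˡ i)
      σ⁻¹-gS i = begin
        Inverse.from σ (gS i)                                  ≡⟨ cong (Inverse.from σ ∘ gS) (sym (inverseʳ perm)) ⟩
        Inverse.from σ (gS (perm ⟨$⟩ʳ (perm ⟨$⟩ˡ i)))          ≡⟨ cong (Inverse.from σ) (sym (σ-gS _)) ⟩
        Inverse.from σ (Inverse.to σ (gS (perm ⟨$⟩ˡ i)))       ≡⟨ Inverse.strictlyInverseʳ σ _ ⟩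
        gS (perm ⟨$⟩ˡ i)                                       ∎

      isAutL : IsAutL (permMat perm)
      isAutL = permMat-isAutL perm (additive-preservesRelations σ-additive σ-gS)
                                   (additive-preservesRelations (from-additive σ σ-additive) σ⁻¹-gS)

    toAutLPerm : AutGS* → AutLPerm
    toAutLPerm t = record { π = Restriction.perm t ; isAut = Restriction.isAutL t }

    toAutLPerm-isMono : IsMono toAutLPerm
    toAutLPerm-isMono = record { hom = record { cong = ≈*⇒≈L ; comp = comp } ; injective = injective }
      where
      open Restriction using (perm; gS-perm)

      ≈*⇒≈L : ∀ t t′ → t ≈* t′ → toAutLPerm t ≈L toAutLPerm t′
      ≈*⇒≈L t t′ t≈t′ i j = permMat-cong (perm t) (perm t′)
        (gS-injective (trans (gS-perm t j) (trans (t≈t′ (gSElt j)) (sym (gS-perm t′ j)))))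

      comp : ∀ t″ t t′ → IsComp* t″ t t′ → IsCompL (toAutLPerm t″) (toAutLPerm t) (toAutLPerm t′)
      comp t″ t t′ t″≡tt′ = permMat-·ₘ (perm t) (perm t′) (perm t″) λ j → gS-injective (begin
        gS (perm t″ ⟨$⟩ʳ j)                      ≡⟨ gS-perm t″ j ⟩
        proj₁ (τ t″ (gSElt j))                   ≡⟨ t″≡tt′ (gSElt j) ⟩
        proj₁ (τ t (τ t′ (gSElt j)))             ≡⟨ cong (proj₁ ∘ τ t) (SElt-≡ (sym (gS-perm t′ j))) ⟩
        proj₁ (τ t (gSElt (perm t′ ⟨$⟩ʳ j)))      ≡⟨ sym (gS-perm t _) ⟩
        gS (perm t ⟨$⟩ʳ (perm t′ ⟨$⟩ʳ j))         ∎)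
        where
        τ : AutGS* → SElt → SElt
        τ t = Inverse.to (AutGS*.τ t)

      injective : ∀ t t′ → toAutLPerm t ≈L toAutLPerm t′ → t ≈* t′
      injective t t′ P≡P′ (a , a∈S) = begin
        proj₁ (Inverse.to (AutGS*.τ t) (a , a∈S))   ≡⟨ τ≡σ t _ ⟩
        Inverse.to (σ t) a                          ≡⟨ additive-agree-on-S (σ-additive t) (σ-additive t′) σt-gS≡σt′-gS a a∈S ⟩
        Inverse.to (σ t′) a                         ≡⟨ sym (τ≡σ t′ _) ⟩
        proj₁ (Inverse.to (AutGS*.τ t′) (a , a∈S))  ∎
        where
        open Restriction using (τ≡σ; σ; σ-additive; σ-gS)
        σt-gS≡σt′-gS : ∀ j → Inverse.to (σ t) (gS j) ≡ Inverse.to (σ t′) (gS j)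
        σt-gS≡σt′-gS j = trans (σ-gS t j) (trans (cong gS (permMat-injective (perm t) (perm t′) P≡P′ j)) (sym (σ-gS t′ j)))

    module _ (generates : Generates) where

      coefficients : ∀ {a} → InSpan a → Σ (Fin k → ℤ) λ c → lincomb gS c ≡ a
      coefficients (span-gen {a} a∈S) with S-cases a a∈S
      ... | inj₁ refl       = (λ _ → + 0) , lincomb-0 gS
      ... | inj₂ (j , refl) = unitVector j , lincomb-unitVector gS j
      coefficients span-0 = (λ _ → + 0) , lincomb-0 gS
      coefficients (span-+ a∈⟨S⟩ b∈⟨S⟩) with coefficients a∈⟨S⟩ | coefficients b∈⟨S⟩
      ... | c , refl | c′ , refl = (λ i → c i ℤ.+ c′ i) , lincomb-+ gS c c′
      coefficients (span-neg a∈⟨S⟩) with coefficients a∈⟨S⟩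
      ... | c , refl = (λ i → ℤ.- c i) , lincomb-neg gS c

      coordinates : Fin N → Fin k → ℤ
      coordinates a = proj₁ (coefficients (generates a))

      lincomb-coordinates : ∀ a → lincomb gS (coordinates a) ≡ a
      lincomb-coordinates a = proj₂ (coefficients (generates a))

      additive-unique : ∀ {φ ψ} → Additive φ → Additive ψ → (∀ j → φ (gS j) ≡ ψ (gS j)) → φ ≗ ψ
      additive-unique {φ} {ψ} φ-additive ψ-additive agree a = on-span (generates a)
        where
        on-span : ∀ {a} → InSpan a → φ a ≡ ψ a
        on-span (span-gen a∈S) = additive-agree-on-S φ-additive ψ-additive agree _ a∈S
        on-span span-0         = trans (additive-𝟘 φ-additive) (sym (additive-𝟘 ψ-additive))
        on-span (span-+ p q)   = trans (φ-additive _ _) (trans (cong₂ _⊕_ (on-span p) (on-span q)) (sym (ψ-additive _ _)))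
        on-span (span-neg p)   = trans (additive-⊖ φ-additive _) (trans (cong ⊖_ (on-span p)) (sym (additive-⊖ ψ-additive _)))

      module Extension (ρ : Fin k → Fin k) (ρ-preserves : PreservesRelations ρ) where

        -- Independent of the chosen coordinates of a, because ρ preserves relations (extend-lincomb).
        extend : Fin N → Fin N
        extend a = lincomb (gS ∘ ρ) (coordinates a)

        extend-lincomb : ∀ c → extend (lincomb gS c) ≡ lincomb (gS ∘ ρ) c
        extend-lincomb c =
          preservesRelations-lincomb ρ-preserves {coordinates (lincomb gS c)} {c} (lincomb-coordinates (lincomb gS c))

        extend-additive : Additive extend
        extend-additive a b = begin
          extend (a ⊕ b)                                ≡⟨ cong extend (sym (cong₂ _⊕_ (lincomb-coordinates a) (lincomb-coordinates b))) ⟩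
          extend (lincomb gS cᵃ ⊕ lincomb gS cᵇ)       ≡⟨ cong extend (sym (lincomb-+ gS cᵃ cᵇ)) ⟩
          extend (lincomb gS (λ i → cᵃ i ℤ.+ cᵇ i))    ≡⟨ extend-lincomb (λ i → cᵃ i ℤ.+ cᵇ i) ⟩
          lincomb (gS ∘ ρ) (λ i → cᵃ i ℤ.+ cᵇ i)       ≡⟨ lincomb-+ (gS ∘ ρ) cᵃ cᵇ ⟩
          extend a ⊕ extend b                           ∎
          where
          cᵃ cᵇ : Fin k → ℤ
          cᵃ = coordinates a
          cᵇ = coordinates b

        extend-gS : ∀ j → extend (gS j) ≡ gS (ρ j)
        extend-gS j = trans (cong extend (sym (lincomb-unitVector gS j)))
                            (trans (extend-lincomb (unitVector j)) (lincomb-unitVector (gS ∘ ρ) j))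

        extend-S : ∀ a → InS a → InS (extend a)
        extend-S a a∈S with S-cases a a∈S
        ... | inj₁ refl       = subst InS (sym (additive-𝟘 extend-additive)) 𝟘∈S
        ... | inj₂ (j , refl) = subst InS (sym (extend-gS j)) (gS∈S (ρ j))

      additive-∘-≗id : ∀ (π : Permutation′ k) {e e′} → Additive e → Additive e′ →
                       (∀ j → e (gS j) ≡ gS (π ⟨$⟩ʳ j)) → (∀ j → e′ (gS j) ≡ gS (π ⟨$⟩ˡ j)) → e ∘ e′ ≗ id
      additive-∘-≗id π {e} {e′} e-additive e′-additive e-gS e′-gS =
        additive-unique (∘-additive e-additive e′-additive) (λ _ _ → refl)
          (λ j → trans (cong e (e′-gS j)) (trans (e-gS _) (cong gS (inverseʳ π))))

      module FromAutLPerm (u : AutLPerm) where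
        open AutLPerm u using (π; isAut)
        module E  = Extension (π ⟨$⟩ʳ_) (proj₁ (isAutL-preservesRelations π isAut))
        module E′ = Extension (π ⟨$⟩ˡ_) (proj₂ (isAutL-preservesRelations π isAut))

        σ : Fin N ↔ Fin N
        σ = mk↔ₛ′ E.extend E′.extend
              (additive-∘-≗id π E.extend-additive E′.extend-additive E.extend-gS E′.extend-gS)
              (additive-∘-≗id (flip π) E′.extend-additive E.extend-additive E′.extend-gS E.extend-gS)

        autGS* : AutGS*
        autGS* = restrictToS σ E.extend-additive E.extend-S E′.extend-S

        perm-autGS* : ∀ j → Restriction.perm autGS* ⟨$⟩ʳ j ≡ π ⟨$⟩ʳ j
        perm-autGS* j = gS-injective (trans (Restriction.gS-perm autGS* j) (E.extend-gS j))

      toAutLPerm-isIso : IsIso toAutLPerm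
      toAutLPerm-isIso = record
        { mono       = toAutLPerm-isMono
        ; surjective = λ u → autGS* u , λ i j → permMat-cong (Restriction.perm (autGS* u)) (AutLPerm.π u) (perm-autGS* u j)
        }
        where open FromAutLPerm using (autGS*; perm-autGS*)

mainTheorem5 : ∀ {N k : ℕ} (G : FinAbGroup N) → toℕ (FinAbGroup.𝟘 G) ≡ 0 → (h : suc k ≤ N) →
    Σ (Setup.AutGS* G h → Setup.AutLPerm G h) (Setup.IsMono G h)
    × (Setup.Generates G h → Σ (Setup.AutGS* G h → Setup.AutLPerm G h) (Setup.IsIso G h))
mainTheorem5 G toℕ-𝟘 h =
  (toAutLPerm G h toℕ-𝟘 , toAutLPerm-isMono G h toℕ-𝟘) ,
  λ generates → toAutLPerm G h toℕ-𝟘 , toAutLPerm-isIso G h toℕ-𝟘 generates
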